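{- For all integers $d\ge 2$, $m\ge 1$ and $k\ge 1$, the de Bruijn digraph $B(d,m)$ satisfies $$\gamma_k(B(d,m)) = \left\lceil d^m \Big/ \sum_{j=0}^k d^j\right\rceil.$$
   Context: The de Bruijn digraph $B(d,m)$ is the generalized de Bruijn digraph $G_B(d^m,d)$: vertex set $\{0,1,\dots,d^m-1\}$ and an arc $(x,y)$ whenever $y\equiv dx+i \pmod{d^m}$ for some $0\le i\le d-1$ (self-loops allowed). A set $D$ of vertices of a digraph $G$ is a distance $k$-dominating set if every vertex $v\notin D$ has some $u\in D$ with a directed path from $u$ to $v$ of length at most $k$. $\gamma_k(G)$ denotes the minimum cardinality of a distance $k$-dominating set of $G$. -}

module Defs where

open import Data.Nat using (ℕ; zero; suc; _+_; _*_; _^_; _≤_; _<_; NonZero)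
open import Data.Nat.DivMod using (_%_; _/_)
open import Data.Fin using (Fin; toℕ)
open import Data.Fin.Subset using (Subset; _∈_; _∉_; ∣_∣)
open import Data.Product using (Σ; ∃; _×_; _,_)
open import Relation.Binary.PropositionalEquality using (_≡_)

Arc : (d m : ℕ) → .{{NonZero (d ^ m)}} → Fin (d ^ m) → Fin (d ^ m) → Set
Arc d m x y = Σ ℕ λ i → i < d × toℕ y ≡ (d * toℕ x + i) % (d ^ m)

data Walk (d m : ℕ) .{{_ : NonZero (d ^ m)}} : ℕ → Fin (d ^ m) → Fin (d ^ m) → Set where
  here : ∀ {u} → Walk d m 0 u u
  step : ∀ {n u w v} → Arc d m u w → Walk d m n w v → Walk d m (suc n) u v

-- Directed path of length at most k from u to v (a shortest walk is a path).
Reaches≤ : (d m : ℕ) → .{{NonZero (d ^ m)}} → ℕ → Fin (d ^ m) → Fin (d ^ m) → Set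
Reaches≤ d m k u v = Σ ℕ λ n → n ≤ k × Walk d m n u v

IsDistDom : (d m k : ℕ) → .{{NonZero (d ^ m)}} → Subset (d ^ m) → Set
IsDistDom d m k D = ∀ v → v ∉ D → Σ (Fin (d ^ m)) λ u → u ∈ D × Reaches≤ d m k u v

IsGammaK : (d m k : ℕ) → .{{NonZero (d ^ m)}} → ℕ → Set
IsGammaK d m k c =
  (Σ (Subset (d ^ m)) λ D → IsDistDom d m k D × ∣ D ∣ ≡ c)
  × (∀ D → IsDistDom d m k D → c ≤ ∣ D ∣)

geomSum : ℕ → ℕ → ℕ
geomSum d zero = 1
geomSum d (suc k) = geomSum d k + d ^ suc k

ceilDiv : (a b : ℕ) → .{{NonZero b}} → ℕ
ceilDiv a b = (a + b Data.Nat.∸ 1) / b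

-- Write n = d ^ m. In j steps a vertex x reaches exactly the vertices
-- d^j x + i (mod n) with i < d^j, so within k steps it reaches at most
-- Σ_{j≤k} d^j of them, and a distance-k dominating set D needs n ≤ ∣D∣ Σ_{j≤k} d^j.
-- Conversely let q = ⌈n / Σ_{j≤k} d^j⌉ and pick α with (d − 1) α ≡ q (mod n), which is
-- possible as d − 1 is a unit modulo d^m. Then d^j α ≡ α + q Σ_{l<j} d^l, so from the
-- window α, α + 1, …, α + q − 1 one reaches in exactly j steps the window of length q d^j
-- starting at α + q Σ_{l<j} d^l. For j ≤ k these windows tile a run of at least n
-- consecutive residues, so the q vertices of the first window dominate everything.
module Submission where

open import Defs
open import Data.Nat using (ℕ; zero; suc; _+_; _*_; _∸_; _^_; _≤_; _<_; _≤′_; ≤′-refl; ≤′-step; pred; NonZero; >-nonZero; z≤n; s≤s; s≤s⁻¹; _<?_)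
open import Data.Nat.Properties
open import Data.Nat.DivMod
open import Data.Nat.Tactic.RingSolver using (solve-∀)
open import Data.Fin using (Fin; toℕ; fromℕ<; combine)
import Data.Fin.Properties as Finₚ
open import Data.Fin.Properties using (toℕ-fromℕ<; toℕ-injective; toℕ<n; fromℕ<-injective; injective⇒≤; combine-injective)
open import Data.Fin.Subset using (Subset; _∈_; ∣_∣; inside; outside)
open import Data.Fin.Subset.Properties using (_∈?_)
open import Data.Vec using (_∷_; here; there; tabulate)
open import Data.Vec.Properties using (lookup∘tabulate; lookup⇒[]=; []=⇒lookup)
open import Data.Product using (∃-syntax; _×_; _,_; proj₂)
open import Level using (0ℓ)
open import Relation.Binary using (Setoid; tri<; tri≈; tri>)
open import Relation.Binary.PropositionalEquality
import Relation.Binary.Reasoning.Setoid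
open import Relation.Nullary using (yes; no; does; proof; contradiction)
open import Relation.Nullary.Decidable using (dec-true)
open import Relation.Nullary.Reflects using (Reflects; invert)
open import Relation.Unary using (Pred; Decidable)

enum : ∀ {n} (p : Subset n) → Fin ∣ p ∣ → Fin n
enum (inside  ∷ p) Fin.zero    = Fin.zero
enum (inside  ∷ p) (Fin.suc i) = Fin.suc (enum p i)
enum (outside ∷ p) i           = Fin.suc (enum p i)

enum-∈ : ∀ {n} (p : Subset n) i → enum p i ∈ p
enum-∈ (inside  ∷ p) Fin.zero    = here
enum-∈ (inside  ∷ p) (Fin.suc i) = there (enum-∈ p i)
enum-∈ (outside ∷ p) i           = there (enum-∈ p i)

enum-injective : ∀ {n} (p : Subset n) {i j} → enum p i ≡ enum p j → i ≡ j
enum-injective (inside  ∷ p) {Fin.zero}  {Fin.zero}  _  = refl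
enum-injective (inside  ∷ p) {Fin.suc i} {Fin.suc j} eq = cong Fin.suc (enum-injective p (Finₚ.suc-injective eq))
enum-injective (outside ∷ p)                         eq = enum-injective p (Finₚ.suc-injective eq)

index : ∀ {n} (p : Subset n) {x} → x ∈ p → Fin ∣ p ∣
index (inside  ∷ p) here        = Fin.zero
index (inside  ∷ p) (there x∈p) = Fin.suc (index p x∈p)
index (outside ∷ p) (there x∈p) = index p x∈p

enum-index : ∀ {n} (p : Subset n) {x} (x∈p : x ∈ p) → enum p (index p x∈p) ≡ x
enum-index (inside  ∷ p) here        = refl
enum-index (inside  ∷ p) (there x∈p) = cong Fin.suc (enum-index p x∈p)
enum-index (outside ∷ p) (there x∈p) = cong Fin.suc (enum-index p x∈p)

index-injective : ∀ {n} (p : Subset n) {x y} (x∈p : x ∈ p) (y∈p : y ∈ p) →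
                  index p x∈p ≡ index p y∈p → x ≡ y
index-injective p x∈p y∈p eq =
  trans (sym (enum-index p x∈p)) (trans (cong (enum p) eq) (enum-index p y∈p))

injectiveOn⇒∣p∣≤ : ∀ {n m} (p : Subset n) (f : ∀ {x} → x ∈ p → Fin m) →
                   (∀ {x y} (x∈p : x ∈ p) (y∈p : y ∈ p) → f x∈p ≡ f y∈p → x ≡ y) → ∣ p ∣ ≤ m
injectiveOn⇒∣p∣≤ p f f-injective =
  injective⇒≤ (λ eq → enum-injective p (f-injective (enum-∈ p _) (enum-∈ p _) eq))

module _ {n} {P : Pred (Fin n) 0ℓ} (P? : Decidable P) where

  decSubset : Subset n
  decSubset = tabulate (λ x → does (P? x))

  ∈decSubset⁺ : ∀ {x} → P x → x ∈ decSubset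
  ∈decSubset⁺ {x} px = lookup⇒[]= x decSubset (trans (lookup∘tabulate _ x) (dec-true (P? x) px))

  ∈decSubset⁻ : ∀ {x} → x ∈ decSubset → P x
  ∈decSubset⁻ {x} x∈ =
    invert (subst (Reflects (P x)) (trans (sym (lookup∘tabulate _ x)) ([]=⇒lookup x∈)) (proof (P? x)))

ceilDiv-least : ∀ a b .{{_ : NonZero b}} c → a ≤ c * b → ceilDiv a b ≤ c
ceilDiv-least a (suc b) c a≤cb = <⇒≤pred (m<n*o⇒m/o<n (begin-strict
  a + suc b ∸ 1     ≡⟨ cong (_∸ 1) (+-suc a b) ⟩
  a + b             ≤⟨ +-monoˡ-≤ b a≤cb ⟩
  c * suc b + b     <⟨ n<1+n _ ⟩
  suc (c * suc b + b) ≡⟨ cong suc (+-comm (c * suc b) b) ⟩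
  suc c * suc b     ∎))
  where open ≤-Reasoning

ceilDiv-covers : ∀ a b .{{_ : NonZero b}} → a ≤ ceilDiv a b * b
ceilDiv-covers a (suc b) rewrite +-suc a b = +-cancelʳ-≤ b a _ (begin
  a + b                          ≡⟨ m≡m%n+[m/n]*n (a + b) (suc b) ⟩
  (a + b) % suc b + Q * suc b    ≤⟨ +-monoˡ-≤ (Q * suc b) (s≤s⁻¹ (m%n<n (a + b) (suc b))) ⟩
  b + Q * suc b                  ≡⟨ +-comm b _ ⟩
  Q * suc b + b                  ∎)
  where open ≤-Reasoning
        Q = (a + b) / suc b

digits< : ∀ {a b i₁ i₂} → i₁ < a → i₂ < b → i₁ * b + i₂ < a * b
digits< {a} {b} {i₁} {i₂} i₁<a i₂<b = begin-strict
  i₁ * b + i₂  <⟨ +-monoʳ-< (i₁ * b) i₂<b ⟩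
  i₁ * b + b   ≡⟨ +-comm (i₁ * b) b ⟩
  suc i₁ * b   ≤⟨ *-monoˡ-≤ b i₁<a ⟩
  a * b        ∎
  where open ≤-Reasoning

-- Σ_{i<j} d^i; the interval [0, geomSum d k) is the disjoint union of the layers
-- [geomSum< d j, geomSum< d j + d ^ j) for j ≤ k.
geomSum< : ℕ → ℕ → ℕ
geomSum< d zero    = 0
geomSum< d (suc j) = geomSum d j

geomSum<+^ : ∀ d j → geomSum< d j + d ^ j ≡ geomSum d j
geomSum<+^ d zero    = refl
geomSum<+^ d (suc j) = refl

geomSum-mono-≤ : ∀ d {j k} → j ≤ k → geomSum d j ≤ geomSum d k
geomSum-mono-≤ d j≤k = go (≤⇒≤′ j≤k)
  where
  go : ∀ {j k} → j ≤′ k → geomSum d j ≤ geomSum d k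
  go ≤′-refl        = ≤-refl
  go (≤′-step j≤′k) = ≤-trans (go j≤′k) (m≤m+n _ _)

layer< : ∀ d {j k i} → j ≤ k → i < d ^ j → geomSum< d j + i < geomSum d k
layer< d {j} {k} {i} j≤k i<dʲ = begin-strict
  geomSum< d j + i      <⟨ +-monoʳ-< (geomSum< d j) i<dʲ ⟩
  geomSum< d j + d ^ j  ≡⟨ geomSum<+^ d j ⟩
  geomSum d j           ≤⟨ geomSum-mono-≤ d j≤k ⟩
  geomSum d k           ∎
  where open ≤-Reasoning

layer<-later : ∀ d {j j′ i i′} → j < j′ → i < d ^ j → geomSum< d j + i < geomSum< d j′ + i′
layer<-later d {j′ = suc j′} (s≤s j≤j′) i<dʲ = <-≤-trans (layer< d j≤j′ i<dʲ) (m≤m+n _ _)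

layer-injective : ∀ d {j j′ i i′} → i < d ^ j → i′ < d ^ j′ →
                  geomSum< d j + i ≡ geomSum< d j′ + i′ → j ≡ j′ × i ≡ i′
layer-injective d {j} {j′} i<dʲ i′<dʲ′ eq with <-cmp j j′
... | tri< j<j′ _ _ = contradiction eq (<⇒≢ (layer<-later d j<j′ i<dʲ))
... | tri> _ _ j>j′ = contradiction (sym eq) (<⇒≢ (layer<-later d j>j′ i′<dʲ′))
... | tri≈ _ refl _ = refl , +-cancelˡ-≡ (geomSum< d j) _ _ eq

layer-split : ∀ d q k {t} → t < q * geomSum d k →
              ∃[ j ] j ≤ k × ∃[ s ] s < q * d ^ j × t ≡ q * geomSum< d j + s
layer-split d q zero    {t} t<q = 0 , z≤n , t , t<q , cong (_+ t) (sym (*-zeroʳ q))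
layer-split d q (suc k) {t} t<q·G with t <? q * geomSum d k
... | yes t<q·G′ = let (j , j≤k , rest) = layer-split d q k t<q·G′ in j , m≤n⇒m≤1+n j≤k , rest
... | no  t≮q·G′ = suc k , ≤-refl , t ∸ q * G′ , s< , sym (m+[n∸m]≡n q·G′≤t)
  where
  G′ = geomSum d k
  q·G′≤t = ≮⇒≥ t≮q·G′
  s< : t ∸ q * G′ < q * d ^ suc k
  s< = +-cancelˡ-< (q * G′) _ _ (subst₂ _<_ (sym (m+[n∸m]≡n q·G′≤t)) (*-distribˡ-+ q G′ _) t<q·G)

^≡1+pred*geomSum< : ∀ d .{{_ : NonZero d}} j → d ^ j ≡ suc (pred d * geomSum< d j)
^≡1+pred*geomSum< (suc e) zero    = cong suc (sym (*-zeroʳ e))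
^≡1+pred*geomSum< (suc e) (suc j) = begin
  suc e ^ j + e * suc e ^ j              ≡⟨ cong (_+ e * suc e ^ j) (^≡1+pred*geomSum< (suc e) j) ⟩
  suc (e * G + e * suc e ^ j)            ≡⟨ cong suc (sym (*-distribˡ-+ e G (suc e ^ j))) ⟩
  suc (e * (G + suc e ^ j))              ≡⟨ cong (λ x → suc (e * x)) (geomSum<+^ (suc e) j) ⟩
  suc (e * geomSum (suc e) j)            ∎
  where open ≡-Reasoning
        G = geomSum< (suc e) j

pred*pred%≡1% : ∀ n .{{_ : NonZero n}} → (pred n * pred n) % n ≡ 1 % n
pred*pred%≡1% (suc zero)    = refl
pred*pred%≡1% (suc (suc p)) = begin
  (suc p * suc p) % suc (suc p)               ≡⟨ cong (_% suc (suc p)) (square p) ⟩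
  (1 + p * suc (suc p)) % suc (suc p)         ≡⟨ [m+kn]%n≡m%n 1 p (suc (suc p)) ⟩
  1 % suc (suc p)                             ∎
  where
  open ≡-Reasoning
  square : ∀ p → suc p * suc p ≡ 1 + p * suc (suc p)
  square = solve-∀

module Modulo (n : ℕ) .{{_ : NonZero n}} where

  -- Congruence modulo n, as a record so that a and b can be inferred from a proof.
  infix 4 _≈_
  record _≈_ (a b : ℕ) : Set where
    constructor mod
    field %-≡ : a % n ≡ b % n

  ≈-setoid : Setoid 0ℓ 0ℓ
  ≈-setoid = record
    { _≈_ = _≈_
    ; isEquivalence = record
      { refl  = mod refl
      ; sym   = λ (mod a≡b) → mod (sym a≡b)
      ; trans = λ (mod a≡b) (mod b≡c) → mod (trans a≡b b≡c)
      }
    }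

  open Setoid ≈-setoid public using () renaming (refl to ≈-refl; sym to ≈-sym; trans to ≈-trans)
  module ≈-Reasoning = Relation.Binary.Reasoning.Setoid ≈-setoid

  ≡⇒≈ : ∀ {a b} → a ≡ b → a ≈ b
  ≡⇒≈ a≡b = mod (cong (_% n) a≡b)

  %≈ : ∀ a → a % n ≈ a
  %≈ a = mod (m%n%n≡m%n a n)

  ≡%⇒≈ : ∀ {a b} → a ≡ b % n → a ≈ b
  ≡%⇒≈ a≡b = ≈-trans (≡⇒≈ a≡b) (%≈ _)

  +-cong : ∀ {a b c e} → a ≈ b → c ≈ e → a + c ≈ b + e
  +-cong {a} {b} {c} {e} (mod a≡b) (mod c≡e) = mod (begin
    (a + c) % n              ≡⟨ %-distribˡ-+ a c n ⟩
    (a % n + c % n) % n      ≡⟨ cong₂ (λ x y → (x + y) % n) a≡b c≡e ⟩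
    (b % n + e % n) % n      ≡⟨ %-distribˡ-+ b e n ⟨
    (b + e) % n              ∎)
    where open ≡-Reasoning

  *-cong : ∀ {a b c e} → a ≈ b → c ≈ e → a * c ≈ b * e
  *-cong {a} {b} {c} {e} (mod a≡b) (mod c≡e) = mod (begin
    (a * c) % n              ≡⟨ %-distribˡ-* a c n ⟩
    (a % n * (c % n)) % n    ≡⟨ cong₂ (λ x y → (x * y) % n) a≡b c≡e ⟩
    (b % n * (e % n)) % n    ≡⟨ %-distribˡ-* b e n ⟨
    (b * e) % n              ∎)
    where open ≡-Reasoning

  +-congˡ : ∀ a {c e} → c ≈ e → a + c ≈ a + e
  +-congˡ a = +-cong (≈-refl {a})

  +-congʳ : ∀ c {a b} → a ≈ b → a + c ≈ b + c
  +-congʳ c a≈b = +-cong a≈b (≈-refl {c})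

  *-congˡ : ∀ a {c e} → c ≈ e → a * c ≈ a * e
  *-congˡ a = *-cong (≈-refl {a})

  +*n≈ : ∀ a k → a + k * n ≈ a
  +*n≈ a k = mod ([m+kn]%n≡m%n a k n)

  pred*pred≈1 : pred n * pred n ≈ 1
  pred*pred≈1 = mod (pred*pred%≡1% n)

  toℕ-≈⇒≡ : ∀ {x y : Fin n} → toℕ x ≈ toℕ y → x ≡ y
  toℕ-≈⇒≡ {x} {y} (mod x≡y) = toℕ-injective (begin
    toℕ x       ≡⟨ m<n⇒m%n≡m (toℕ<n x) ⟨
    toℕ x % n   ≡⟨ x≡y ⟩
    toℕ y % n   ≡⟨ m<n⇒m%n≡m (toℕ<n y) ⟩
    toℕ y       ∎)
    where open ≡-Reasoning

module DeBruijn (d m : ℕ) .{{_ : NonZero (d ^ m)}} where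

  n : ℕ
  n = d ^ m

  open Modulo n

  vertex : ℕ → Fin n
  vertex a = fromℕ< (m%n<n a n)

  toℕ-vertex : ∀ a → toℕ (vertex a) ≡ a % n
  toℕ-vertex a = toℕ-fromℕ< (m%n<n a n)

  vertex≈ : ∀ a → toℕ (vertex a) ≈ a
  vertex≈ a = ≡%⇒≈ (toℕ-vertex a)

  -- v is obtained from x by shifting j new digits (base d) in on the right.
  Shift : ℕ → Fin n → Fin n → Set
  Shift j x v = ∃[ i ] i < d ^ j × toℕ v ≈ d ^ j * toℕ x + i

  d⁰*a+0≡a : ∀ a → d ^ 0 * a + 0 ≡ a
  d⁰*a+0≡a a = trans (+-identityʳ _) (*-identityˡ a)

  shift-refl : ∀ x → Shift 0 x x
  shift-refl x = 0 , s≤s z≤n , ≡⇒≈ (sym (d⁰*a+0≡a (toℕ x)))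

  walk⇒shift : ∀ {j x v} → Walk d m j x v → Shift j x v
  walk⇒shift {x = x} here = shift-refl x
  walk⇒shift {suc j} {x} {v} (step {w = w} (i₁ , i₁<d , w≡) w⇝v) =
    let (i₂ , i₂<dʲ , v≈) = walk⇒shift w⇝v in
    i₁ * d ^ j + i₂ , digits< i₁<d i₂<dʲ , (begin
      toℕ v                                 ≈⟨ v≈ ⟩
      d ^ j * toℕ w + i₂                    ≈⟨ +-congʳ i₂ (*-congˡ (d ^ j) (≡%⇒≈ w≡)) ⟩
      d ^ j * (d * toℕ x + i₁) + i₂         ≡⟨ regroup (d ^ j) d (toℕ x) i₁ i₂ ⟩
      d * d ^ j * toℕ x + (i₁ * d ^ j + i₂) ∎)
    where
    open ≈-Reasoning
    regroup : ∀ D d x i₁ i₂ → D * (d * x + i₁) + i₂ ≡ d * D * x + (i₁ * D + i₂)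
    regroup = solve-∀

  shift⇒walk : .{{_ : NonZero d}} → ∀ j {x v} → Shift j x v → Walk d m j x v
  shift⇒walk zero    (suc _ , s≤s () , _)
  shift⇒walk zero    {x} {v} (zero , _ , v≈) =
    subst (Walk d m 0 x) (toℕ-≈⇒≡ (≈-sym (≈-trans v≈ (≡⇒≈ (d⁰*a+0≡a (toℕ x)))))) here
  shift⇒walk (suc j) {x} {v} (i , i<d·dʲ , v≈) =
    step (i / d ^ j , m<n*o⇒m/o<n i<d·dʲ , toℕ-vertex _)
         (shift⇒walk j (i % d ^ j , m%n<n i (d ^ j) , v≈′))
    where
    instance _ = m^n≢0 d j
    w = vertex (d * toℕ x + i / d ^ j)
    open ≈-Reasoning
    regroup : ∀ D d x r i → d * D * x + (i + r * D) ≡ D * (d * x + r) + i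
    regroup = solve-∀
    v≈′ : toℕ v ≈ d ^ j * toℕ w + i % d ^ j
    v≈′ = begin
      toℕ v                                                 ≈⟨ v≈ ⟩
      d * d ^ j * toℕ x + i                                 ≡⟨ cong (d * d ^ j * toℕ x +_) (m≡m%n+[m/n]*n i (d ^ j)) ⟩
      d * d ^ j * toℕ x + (i % d ^ j + i / d ^ j * d ^ j)   ≡⟨ regroup (d ^ j) d (toℕ x) (i / d ^ j) (i % d ^ j) ⟩
      d ^ j * (d * toℕ x + i / d ^ j) + i % d ^ j           ≈⟨ +-congʳ (i % d ^ j) (*-congˡ (d ^ j) (vertex≈ _)) ⟨
      d ^ j * toℕ w + i % d ^ j                             ∎

  record Dominator (k : ℕ) (D : Subset n) (v : Fin n) : Set where
    constructor dominator
    field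
      source     : Fin n
      source∈D   : source ∈ D
      distance   : ℕ
      distance≤k : distance ≤ k
      shift      : Shift distance source v

  dominator-of : ∀ {k D} → IsDistDom d m k D → ∀ v → Dominator k D v
  dominator-of {D = D} D-dom v with v ∈? D
  ... | yes v∈D = dominator v v∈D 0 z≤n (shift-refl v)
  ... | no  v∉D = let (u , u∈D , j , j≤k , u⇝v) = D-dom v v∉D in dominator u u∈D j j≤k (walk⇒shift u⇝v)

  encode : ∀ {k D v} → Dominator k D v → Fin (∣ D ∣ * geomSum d k)
  encode {D = D} (dominator u u∈D j j≤k (i , i<dʲ , _)) =
    combine (index D u∈D) (fromℕ< (layer< d j≤k i<dʲ))

  encode-injective : ∀ {k D v v′} (a : Dominator k D v) (b : Dominator k D v′) →
                     encode a ≡ encode b → v ≡ v′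
  encode-injective {D = D} (dominator u u∈D j j≤k (i , i<dʲ , v≈))
                           (dominator u′ u′∈D j′ j′≤k (i′ , i′<dʲ′ , v′≈)) eq
    with combine-injective _ _ _ _ eq
  ... | same-source , same-layer
    with index-injective D u∈D u′∈D same-source
       | layer-injective d {j} {j′} i<dʲ i′<dʲ′
           (fromℕ<-injective _ _ (layer< d j≤k i<dʲ) (layer< d j′≤k i′<dʲ′) same-layer)
  ... | refl | refl , refl = toℕ-≈⇒≡ (≈-trans v≈ (≈-sym v′≈))

  dominating⇒n≤∣D∣*geomSum : ∀ {k D} → IsDistDom d m k D → n ≤ ∣ D ∣ * geomSum d k
  dominating⇒n≤∣D∣*geomSum D-dom =
    injective⇒≤ (λ {v} {v′} → encode-injective (dominator-of D-dom v) (dominator-of D-dom v′))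

  pred[d]*-surjective : .{{_ : NonZero d}} → ∀ q → ∃[ α ] pred d * α ≈ q
  pred[d]*-surjective q = q * (G * pred n) , (begin
    pred d * (q * (G * pred n))   ≡⟨ regroup (pred d) q G (pred n) ⟩
    q * ((pred d * G) * pred n)   ≡⟨ cong (λ x → q * (x * pred n)) (cong pred (^≡1+pred*geomSum< d m)) ⟨
    q * (pred n * pred n)         ≈⟨ *-congˡ q pred*pred≈1 ⟩
    q * 1                         ≡⟨ *-identityʳ q ⟩
    q                             ∎)
    where
    open ≈-Reasoning
    G = geomSum< d m
    regroup : ∀ e q G N → e * (q * (G * N)) ≡ q * ((e * G) * N)
    regroup = solve-∀

  module Construction .{{_ : NonZero d}} {k q α : ℕ}
                      (n≤q*geomSum : n ≤ q * geomSum d k) (α-inverts : pred d * α ≈ q) where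

    d^j*α≈ : ∀ j → d ^ j * α ≈ α + geomSum< d j * q
    d^j*α≈ j = begin
      d ^ j * α                      ≡⟨ cong (_* α) (^≡1+pred*geomSum< d j) ⟩
      suc (pred d * G) * α           ≡⟨ regroup (pred d) G α ⟩
      α + G * (pred d * α)           ≈⟨ +-congˡ α (*-congˡ G α-inverts) ⟩
      α + G * q                      ∎
      where
      open ≈-Reasoning
      G = geomSum< d j
      regroup : ∀ e G α → suc (e * G) * α ≡ α + G * (e * α)
      regroup = solve-∀

    α+[a+pred[n]*α]≈a : ∀ a → α + (a + pred n * α) ≈ a
    α+[a+pred[n]*α]≈a a = begin
      α + (a + pred n * α)         ≡⟨ regroup α a (pred n) ⟩
      a + α * suc (pred n)         ≡⟨ cong (λ c → a + α * c) (suc-pred n) ⟩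
      a + α * n                    ≈⟨ +*n≈ a α ⟩
      a                            ∎
      where
      open ≈-Reasoning
      regroup : ∀ α a N → α + (a + N * α) ≡ a + α * suc N
      regroup = solve-∀

    -- offset x represents toℕ x − α modulo n.
    offset : Fin n → ℕ
    offset x = (toℕ x + pred n * α) % n

    α+offset≈ : ∀ x → α + offset x ≈ toℕ x
    α+offset≈ x = ≈-trans (+-congˡ α (%≈ _)) (α+[a+pred[n]*α]≈a (toℕ x))

    offset-injective : ∀ {x y} → offset x ≡ offset y → x ≡ y
    offset-injective {x} {y} eq =
      toℕ-≈⇒≡ (≈-trans (≈-sym (α+offset≈ x)) (≈-trans (≡⇒≈ (cong (α +_) eq)) (α+offset≈ y)))

    offset≡ : ∀ {x r} → toℕ x ≈ α + r → offset x ≡ r % n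
    offset≡ {x} {r} x≈α+r = _≈_.%-≡ (begin
      toℕ x + pred n * α           ≈⟨ +-congʳ (pred n * α) x≈α+r ⟩
      α + r + pred n * α           ≡⟨ +-assoc α r _ ⟩
      α + (r + pred n * α)         ≈⟨ α+[a+pred[n]*α]≈a r ⟩
      r                            ∎)
      where open ≈-Reasoning

    offset<q? : Decidable (λ x → offset x < q)
    offset<q? x = offset x <? q

    D : Subset n
    D = decSubset offset<q?

    ∣D∣≤q : ∣ D ∣ ≤ q
    ∣D∣≤q = injectiveOn⇒∣p∣≤ D (λ x∈D → fromℕ< (∈decSubset⁻ offset<q? x∈D))
      (λ x∈D y∈D eq → offset-injective
        (fromℕ<-injective _ _ (∈decSubset⁻ offset<q? x∈D) (∈decSubset⁻ offset<q? y∈D) eq))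

    reach-layer : ∀ j {s v} → s < q * d ^ j → toℕ v ≈ α + (q * geomSum< d j + s) →
                  ∃[ x ] x ∈ D × Walk d m j x v
    reach-layer j {s} {v} s<q·dʲ v≈ = x , x∈D , shift⇒walk j (i , m%n<n s (d ^ j) , v≈′)
      where
      instance _ = m^n≢0 d j
      G = geomSum< d j
      r = s / d ^ j
      i = s % d ^ j
      x = vertex (α + r)
      x∈D : x ∈ D
      x∈D = ∈decSubset⁺ offset<q? (begin-strict
        offset x  ≡⟨ offset≡ (vertex≈ (α + r)) ⟩
        r % n     ≤⟨ m%n≤m r n ⟩
        r         <⟨ m<n*o⇒m/o<n s<q·dʲ ⟩
        q         ∎)
        where open ≤-Reasoning
      regroup₁ : ∀ α q G i r D → α + (q * G + (i + r * D)) ≡ α + G * q + (r * D + i)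
      regroup₁ = solve-∀
      regroup₂ : ∀ α r i D → D * α + (r * D + i) ≡ D * (α + r) + i
      regroup₂ = solve-∀
      v≈′ : toℕ v ≈ d ^ j * toℕ x + i
      v≈′ = begin
        toℕ v                           ≈⟨ v≈ ⟩
        α + (q * G + s)                 ≡⟨ cong (λ s → α + (q * G + s)) (m≡m%n+[m/n]*n s (d ^ j)) ⟩
        α + (q * G + (i + r * d ^ j))   ≡⟨ regroup₁ α q G i r (d ^ j) ⟩
        α + G * q + (r * d ^ j + i)     ≈⟨ +-congʳ (r * d ^ j + i) (d^j*α≈ j) ⟨
        d ^ j * α + (r * d ^ j + i)     ≡⟨ regroup₂ α r i (d ^ j) ⟩
        d ^ j * (α + r) + i             ≈⟨ +-congʳ i (*-congˡ (d ^ j) (vertex≈ (α + r))) ⟨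
        d ^ j * toℕ x + i               ∎
        where open ≈-Reasoning

    D-dominating : IsDistDom d m k D
    D-dominating v _ =
      let (j , j≤k , s , s< , t≡) = layer-split d q k (<-≤-trans (m%n<n _ n) n≤q*geomSum)
          (x , x∈D , x⇝v) = reach-layer j s< (≈-trans (≈-sym (α+offset≈ v)) (≡⇒≈ (cong (α +_) t≡)))
      in x , x∈D , j , j≤k , x⇝v

  γ≡ceilDiv : .{{_ : NonZero d}} (k : ℕ) .{{_ : NonZero (geomSum d k)}} →
              IsGammaK d m k (ceilDiv n (geomSum d k))
  γ≡ceilDiv k = (D , D-dominating , ≤-antisym ∣D∣≤q (q≤ D D-dominating)) , q≤
    where
    q = ceilDiv n (geomSum d k)
    q≤ : ∀ D′ → IsDistDom d m k D′ → q ≤ ∣ D′ ∣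
    q≤ D′ D′-dom = ceilDiv-least n (geomSum d k) ∣ D′ ∣ (dominating⇒n≤∣D∣*geomSum D′-dom)
    open Construction {k = k} (ceilDiv-covers n (geomSum d k)) (proj₂ (pred[d]*-surjective q))

corollary2p3 : (d m k : ℕ) → 2 ≤ d → 1 ≤ m → 1 ≤ k → (nz : NonZero (d ^ m)) → (gz : NonZero (geomSum d k)) → IsGammaK d m k {{nz}} (ceilDiv (d ^ m) (geomSum d k) {{gz}})
corollary2p3 d m k 2≤d _ _ nz gz =
  DeBruijn.γ≡ceilDiv d m {{nz}} {{>-nonZero (≤-trans (s≤s z≤n) 2≤d)}} k {{gz}}
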